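{- Let $A$ be a finite non-empty alphabet, let $\lambda$ be a left-infinite word and $\rho$ a right-infinite word over $A$. Then the set $OG_{\lambda,\rho}=\{og(\lambda_n,\rho_n):n\in\mathbb{N}\}$ is finite if and only if the set $ROG_{\lambda,\rho}=\{rog(\lambda_n,\rho_n):n\in\mathbb{N}\}$ is finite.
   Context: $\mathbb{N}=\{0,1,2,\dots\}$. A left-infinite word is a sequence $\cdots a_{ -2}a_{ -1}a_0$ of letters indexed by $-\mathbb{N}$; a right-infinite word is a sequence $a_0a_1a_2\cdots$ indexed by $\mathbb{N}$. For $n\in\mathbb{N}$, $\lambda_n$ is the suffix of length $n$ of $\lambda$ and $\rho_n$ the prefix of length $n$ of $\rho$. For finite words $u,v$ of equal length: $log(u,v)=\min\{n\in\mathbb{N}: ux=x'v \text{ for some words } x,x' \text{ of length } n\}$, $rog(u,v)=\min\{n\in\mathbb{N}: xu=vx' \text{ for some words } x,x' \text{ of length } n\}$, and $og(u,v)=\min\{log(u,v),rog(u,v)\}$. -}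

module Defs where

open import Data.Nat using (ℕ; _<_; _⊓_)
open import Data.Fin using (Fin)
open import Data.List using (List; length; _++_; reverse; applyUpTo)
open import Data.List.Membership.Propositional using (_∈_)
open import Data.Product using (Σ; ∃; _×_)
open import Relation.Binary.PropositionalEquality using (_≡_)
open import Relation.Nullary using (¬_)

-- A left-infinite word  ⋯ a₋₂ a₋₁ a₀  over A is represented by  l : ℕ → A
-- with  l i = a₋ᵢ.  A right-infinite word  a₀ a₁ a₂ ⋯  by  r : ℕ → A  with  r i = aᵢ.
LeftWord : Set → Set
LeftWord A = ℕ → A

RightWord : Set → Set
RightWord A = ℕ → A

suffix : {A : Set} → LeftWord A → ℕ → List A
suffix l n = reverse (applyUpTo l n)

prefix : {A : Set} → RightWord A → ℕ → List A
prefix r n = applyUpTo r n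

LogWitness : {A : Set} → List A → List A → ℕ → Set
LogWitness {A} u v n =
  Σ (List A) λ x → Σ (List A) λ x' →
    length x ≡ n × length x' ≡ n × u ++ x ≡ x' ++ v

RogWitness : {A : Set} → List A → List A → ℕ → Set
RogWitness {A} u v n =
  Σ (List A) λ x → Σ (List A) λ x' →
    length x ≡ n × length x' ≡ n × x ++ u ≡ v ++ x'

IsMin : (ℕ → Set) → ℕ → Set
IsMin P m = P m × (∀ k → k < m → ¬ P k)

LogIs : {A : Set} → List A → List A → ℕ → Set
LogIs u v = IsMin (LogWitness u v)

RogIs : {A : Set} → List A → List A → ℕ → Set
RogIs u v = IsMin (RogWitness u v)

OgIs : {A : Set} → List A → List A → ℕ → Set
OgIs u v m = ∃ λ a → ∃ λ b → LogIs u v a × RogIs u v b × m ≡ a ⊓ b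

OG : {A : Set} → LeftWord A → RightWord A → ℕ → Set
OG l r m = ∃ λ n → OgIs (suffix l n) (prefix r n) m

ROG : {A : Set} → LeftWord A → RightWord A → ℕ → Set
ROG l r m = ∃ λ n → RogIs (suffix l n) (prefix r n) m

Finite : (ℕ → Set) → Set
Finite P = ∃ λ (xs : List ℕ) → ∀ m → P m → m ∈ xs

-- Since og ≤ rog, a bound on ROG bounds OG.  Conversely, let og be bounded by B, and
-- compare the pair of length n with the pair of length n + (B + 1), which extends it by
-- B + 1 letters on the outer sides.  If rog = b ≤ B at the longer length, the same
-- overlap read inside the shorter pair gives rog ≤ b + B + 1 there.  If log = a ≤ B at
-- the longer length, that overlap matches the inner u against the inner v shifted by
-- B + 1 − a, a right overlap, so rog ≤ B + 1 there.  Hence ROG is bounded by 2B + 1.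
module Submission where

open import Defs
open import Data.Nat using (ℕ; suc; zero; _+_; _∸_; _≤_; _<_; _⊓_; s≤s; z<s; s<s; s<s⁻¹)
open import Data.Nat.Properties
open import Data.Fin using (Fin)
open import Data.Fin.Properties using () renaming (_≟_ to _≟ᶠ_)
open import Data.Product using (_×_; _,_; ∃; proj₁)
open import Data.Sum using (_⊎_; inj₁; inj₂)
open import Data.List using (List; []; _∷_; length; _++_; reverse; applyUpTo; upTo; take; drop)
open import Data.List.Properties
  using (∷-injectiveˡ; ∷-injectiveʳ; ++-assoc; length-++; length-take; length-drop;
         take++drop≡id; reverse-++; length-reverse; length-applyUpTo; ≡-dec)
open import Data.List.Extrema.Nat using (max; xs≤max)
open import Data.List.Membership.Propositional.Properties using (∈-upTo⁺)
import Data.List.Relation.Unary.All as All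
open import Function using (_∘_; _⇔_; mk⇔; Equivalence)
open import Function.Properties.Equivalence using () renaming (sym to ⇔-sym)
open import Relation.Binary.Definitions using (DecidableEquality)
open import Relation.Binary.PropositionalEquality
open import Relation.Nullary using (Dec; yes; no; contradiction)
open import Relation.Nullary.Decidable using (map)

IsMin-≤ : ∀ {P : ℕ → Set} {m k} → IsMin P m → P k → m ≤ k
IsMin-≤ {m = m} {k} (_ , below) pk with m ≤? k
... | yes m≤k = m≤k
... | no m≰k = contradiction pk (below k (≰⇒> m≰k))

IsMin-cong : ∀ {P Q : ℕ → Set} → (∀ k → P k ⇔ Q k) → ∀ {m} → IsMin P m → IsMin Q m
IsMin-cong P⇔Q {m} (pm , below) =
  Equivalence.to (P⇔Q m) pm , λ k k<m → below k k<m ∘ Equivalence.from (P⇔Q k)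

least : ∀ {P : ℕ → Set} m → (∀ k → k < m → Dec (P k)) → P m → ∃ (IsMin P)
least zero _ pm = 0 , pm , λ _ ()
least (suc m) P? pm with P? 0 z<s
... | yes p0 = 0 , p0 , λ _ ()
... | no ¬p0 with least m (λ k k<m → P? (suc k) (s<s k<m)) pm
...   | j , pj , below = suc j , pj , λ { zero _ → ¬p0 ; (suc k) k<j → below k (s<s⁻¹ k<j) }

Bounded : (ℕ → Set) → Set
Bounded P = ∃ λ B → ∀ m → P m → m ≤ B

finite⇒bounded : ∀ {P} → Finite P → Bounded P
finite⇒bounded (xs , P⊆xs) = max 0 xs , λ m pm → All.lookup (xs≤max 0 xs) (P⊆xs m pm)

bounded⇒finite : ∀ {P} → Bounded P → Finite P
bounded⇒finite (B , P≤B) = upTo (suc B) , λ m pm → ∈-upTo⁺ (s≤s (P≤B m pm))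

m⊓n≤o⇒m≤o⊎n≤o : ∀ m n {o} → m ⊓ n ≤ o → m ≤ o ⊎ n ≤ o
m⊓n≤o⇒m≤o⊎n≤o m n m⊓n≤o with ⊓-sel m n
... | inj₁ m⊓n≡m = inj₁ (subst (_≤ _) m⊓n≡m m⊓n≤o)
... | inj₂ m⊓n≡n = inj₂ (subst (_≤ _) m⊓n≡n m⊓n≤o)

module _ {A : Set} where

  ++-equidivisible : ∀ {k} (xs ys zs ws : List A) → length xs + k ≡ length zs →
                     xs ++ ys ≡ zs ++ ws → ∃ λ m → length m ≡ k × zs ≡ xs ++ m × ys ≡ m ++ ws
  ++-equidivisible [] ys zs ws |zs| eq = zs , sym |zs| , refl , eq
  ++-equidivisible (x ∷ xs) ys (z ∷ zs) ws |xs|+k≡|zs| eq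
    with m , |m| , zs≡xs++m , ys≡m++ws ←
         ++-equidivisible xs ys zs ws (suc-injective |xs|+k≡|zs|) (∷-injectiveʳ eq)
    = m , |m| , cong₂ _∷_ (sym (∷-injectiveˡ eq)) zs≡xs++m , ys≡m++ws

  take-length-++ : ∀ (xs ys : List A) → take (length xs) (xs ++ ys) ≡ xs
  take-length-++ [] ys = refl
  take-length-++ (x ∷ xs) ys = cong (x ∷_) (take-length-++ xs ys)

  drop-length-++ : ∀ (xs ys : List A) → drop (length xs) (xs ++ ys) ≡ ys
  drop-length-++ [] ys = refl
  drop-length-++ (x ∷ xs) ys = drop-length-++ xs ys

  applyUpTo-+ : ∀ (f : ℕ → A) m n → applyUpTo f (m + n) ≡ applyUpTo f m ++ applyUpTo (f ∘ (m +_)) n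
  applyUpTo-+ f zero n = refl
  applyUpTo-+ f (suc m) n = cong (f 0 ∷_) (applyUpTo-+ (f ∘ suc) m n)

  logWitness⇔rogWitness-swap : ∀ {u v : List A} K → LogWitness u v K ⇔ RogWitness v u K
  logWitness⇔rogWitness-swap K = mk⇔
    (λ (x , x' , |x| , |x'| , eq) → x' , x , |x'| , |x| , sym eq)
    (λ (x , x' , |x| , |x'| , eq) → x' , x , |x'| , |x| , sym eq)

  rogWitness-shrink : ∀ {k d} (s u v t : List A) → length s ≡ d → length t ≡ d →
                      RogWitness (s ++ u) (v ++ t) k → RogWitness u v (k + d)
  rogWitness-shrink {k} {d} s u v t |s| |t| (x , x' , |x| , |x'| , eq) =
    x ++ s , t ++ x' , |x++s| , |t++x'| , (begin
      (x ++ s) ++ u   ≡⟨ ++-assoc x s u ⟩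
      x ++ (s ++ u)   ≡⟨ eq ⟩
      (v ++ t) ++ x'  ≡⟨ ++-assoc v t x' ⟩
      v ++ (t ++ x')  ∎)
    where
    open ≡-Reasoning
    |x++s| : length (x ++ s) ≡ k + d
    |x++s| = trans (length-++ x) (cong₂ _+_ |x| |s|)
    |t++x'| : length (t ++ x') ≡ k + d
    |t++x'| = trans (length-++ t) (trans (cong₂ _+_ |t| |x'|) (+-comm d k))

  -- s = x' y and t = y' x: the part y of s beyond the left overlap x' shifts u onto v.
  logWitness⇒rogWitness-shrink : ∀ {a e} (s u v t : List A) → length s ≡ a + e → length t ≡ a + e →
                                 length u ≡ length v → LogWitness (s ++ u) (v ++ t) a → RogWitness u v e
  logWitness⇒rogWitness-shrink {a} {e} s u v t |s| |t| |u|≡|v| (x , x' , |x| , |x'| , eq)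
    with ++-equidivisible x' (v ++ t) s (u ++ x) (trans (cong (_+ e) |x'|) (sym |s|))
                          (trans (sym eq) (++-assoc s u x))
  ... | y , |y| , _ , v++t≡y++[u++x]
    with ++-equidivisible v t (y ++ u) x
           (trans (+-comm _ e) (sym (trans (length-++ y) (cong₂ _+_ |y| |u|≡|v|))))
           (trans v++t≡y++[u++x] (sym (++-assoc y u x)))
  ...   | y' , |y'| , y++u≡v++y' , _ = y , y' , |y| , |y'| , y++u≡v++y'

  length-suffix : ∀ (l : LeftWord A) n → length (suffix l n) ≡ n
  length-suffix l n = trans (length-reverse (applyUpTo l n)) (length-applyUpTo l n)

  length-prefix : ∀ (r : RightWord A) n → length (prefix r n) ≡ n
  length-prefix = length-applyUpTo

  suffix-+ : ∀ (l : LeftWord A) n d → suffix l (n + d) ≡ suffix (l ∘ (n +_)) d ++ suffix l n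
  suffix-+ l n d = trans (cong reverse (applyUpTo-+ l n d)) (reverse-++ (applyUpTo l n) _)

  prefix-+ : ∀ (r : RightWord A) n d → prefix r (n + d) ≡ prefix r n ++ prefix (r ∘ (n +_)) d
  prefix-+ = applyUpTo-+

module _ {A : Set} {n : ℕ} (u v : List A) (|u| : length u ≡ n) (|v| : length v ≡ n) where

  rogWitness-length : RogWitness u v n
  rogWitness-length = v , u , |v| , |u| , refl

  -- The overlap of a right witness is forced: x = take K v and x' = drop (n ∸ K) u.
  rogWitness⇔drop≡take : ∀ {K} → K ≤ n → RogWitness u v K ⇔ (drop K v ≡ take (n ∸ K) u)
  rogWitness⇔drop≡take {K} K≤n = mk⇔ to from
    where
    K+[n∸K]≡|v| : K + (n ∸ K) ≡ length v
    K+[n∸K]≡|v| = trans (m+[n∸m]≡n K≤n) (sym |v|)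
    to : RogWitness u v K → drop K v ≡ take (n ∸ K) u
    to (x , x' , |x| , |x'| , eq)
      with m , |m| , v≡x++m , u≡m++x' ← ++-equidivisible x u v x' (trans (cong (_+ (n ∸ K)) |x|) K+[n∸K]≡|v|) eq
      = begin
          drop K v                   ≡⟨ cong₂ drop (sym |x|) v≡x++m ⟩
          drop (length x) (x ++ m)   ≡⟨ drop-length-++ x m ⟩
          m                          ≡⟨ take-length-++ m x' ⟨
          take (length m) (m ++ x')  ≡⟨ cong₂ take |m| (sym u≡m++x') ⟩
          take (n ∸ K) u             ∎
      where
      open ≡-Reasoning
    from : drop K v ≡ take (n ∸ K) u → RogWitness u v K
    from drop≡take = take K v , drop (n ∸ K) u , |take| , |drop| , (begin
        take K v ++ u                                   ≡⟨ cong (take K v ++_) (take++drop≡id (n ∸ K) u) ⟨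
        take K v ++ (take (n ∸ K) u ++ drop (n ∸ K) u)  ≡⟨ cong (λ w → take K v ++ (w ++ drop (n ∸ K) u)) drop≡take ⟨
        take K v ++ (drop K v ++ drop (n ∸ K) u)        ≡⟨ ++-assoc (take K v) _ _ ⟨
        (take K v ++ drop K v) ++ drop (n ∸ K) u        ≡⟨ cong (_++ drop (n ∸ K) u) (take++drop≡id K v) ⟩
        v ++ drop (n ∸ K) u                             ∎)
      where
      open ≡-Reasoning
      |take| : length (take K v) ≡ K
      |take| = trans (length-take K v) (trans (cong (K ⊓_) |v|) (m≤n⇒m⊓n≡m K≤n))
      |drop| : length (drop (n ∸ K) u) ≡ K
      |drop| = trans (length-drop (n ∸ K) u) (trans (cong (_∸ (n ∸ K)) |u|) (m∸[m∸n]≡n K≤n))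

  rogWitness? : DecidableEquality A → ∀ {K} → K ≤ n → Dec (RogWitness u v K)
  rogWitness? _≟_ K≤n = map (⇔-sym (rogWitness⇔drop≡take K≤n)) (≡-dec _≟_ _ _)

  rogIs-exists : DecidableEquality A → ∃ (RogIs u v)
  rogIs-exists _≟_ = least n (λ K K<n → rogWitness? _≟_ (<⇒≤ K<n)) rogWitness-length

logIs-exists : ∀ {A : Set} {n} (u v : List A) → length u ≡ n → length v ≡ n → DecidableEquality A →
               ∃ (LogIs u v)
logIs-exists u v |u| |v| _≟_ with m , rogIs ← rogIs-exists v u |v| |u| _≟_ =
  m , IsMin-cong (λ K → ⇔-sym (logWitness⇔rogWitness-swap K)) rogIs

module _ {A : Set} (_≟_ : DecidableEquality A) (l : LeftWord A) (r : RightWord A) where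

  rogIs-suffix-prefix : ∀ n → ∃ (RogIs (suffix l n) (prefix r n))
  rogIs-suffix-prefix n = rogIs-exists (suffix l n) (prefix r n) (length-suffix l n) (length-prefix r n) _≟_

  logIs-suffix-prefix : ∀ n → ∃ (LogIs (suffix l n) (prefix r n))
  logIs-suffix-prefix n = logIs-exists (suffix l n) (prefix r n) (length-suffix l n) (length-prefix r n) _≟_

  rogWitness-suffix-prefix-+ : ∀ n d {k} → RogWitness (suffix l (n + d)) (prefix r (n + d)) k →
                               RogWitness (suffix l n) (prefix r n) (k + d)
  rogWitness-suffix-prefix-+ n d {k} w =
    rogWitness-shrink _ _ _ _ (length-suffix _ d) (length-prefix _ d)
      (subst₂ (λ u v → RogWitness u v k) (suffix-+ l n d) (prefix-+ r n d) w)

  logWitness-suffix-prefix-+ : ∀ n {a d} → a ≤ d → LogWitness (suffix l (n + d)) (prefix r (n + d)) a →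
                               RogWitness (suffix l n) (prefix r n) (d ∸ a)
  logWitness-suffix-prefix-+ n {a} {d} a≤d w =
    logWitness⇒rogWitness-shrink _ _ _ _ |s| |t| (trans (length-suffix l n) (sym (length-prefix r n)))
      (subst₂ (λ u v → LogWitness u v a) (suffix-+ l n d) (prefix-+ r n d) w)
    where
    |s| : length (suffix (l ∘ (n +_)) d) ≡ a + (d ∸ a)
    |s| = trans (length-suffix _ d) (sym (m+[n∸m]≡n a≤d))
    |t| : length (prefix (r ∘ (n +_)) d) ≡ a + (d ∸ a)
    |t| = trans (length-prefix _ d) (sym (m+[n∸m]≡n a≤d))

  ROG-bounded⇒OG-bounded : Bounded (ROG l r) → Bounded (OG l r)
  ROG-bounded⇒OG-bounded (B , rog≤B) =
    B , λ { _ (n , a , b , _ , rogIs , refl) → ≤-trans (m⊓n≤n a b) (rog≤B b (n , rogIs)) }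

  OG-bounded⇒ROG-bounded : Bounded (OG l r) → Bounded (ROG l r)
  OG-bounded⇒ROG-bounded (B , og≤B) = B + suc B , rog≤
    where
    open ≤-Reasoning
    rog≤ : ∀ m → ROG l r m → m ≤ B + suc B
    rog≤ m (n , rogIs)
      with a , logIs ← logIs-suffix-prefix (n + suc B)
         | b , rogIs′ ← rogIs-suffix-prefix (n + suc B)
      with m⊓n≤o⇒m≤o⊎n≤o a b (og≤B (a ⊓ b) (n + suc B , a , b , logIs , rogIs′ , refl))
    ... | inj₁ a≤B = begin
      m          ≤⟨ IsMin-≤ rogIs (logWitness-suffix-prefix-+ n (m≤n⇒m≤1+n a≤B) (proj₁ logIs)) ⟩
      suc B ∸ a  ≤⟨ m∸n≤m (suc B) a ⟩
      suc B      ≤⟨ m≤n+m (suc B) B ⟩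
      B + suc B  ∎
    ... | inj₂ b≤B = begin
      m          ≤⟨ IsMin-≤ rogIs (rogWitness-suffix-prefix-+ n (suc B) (proj₁ rogIs′)) ⟩
      b + suc B  ≤⟨ +-monoˡ-≤ (suc B) b≤B ⟩
      B + suc B  ∎

proposition3p1 : (k : ℕ) (l : LeftWord (Fin (suc k))) (r : RightWord (Fin (suc k))) →
    (Finite (OG l r) → Finite (ROG l r)) × (Finite (ROG l r) → Finite (OG l r))
proposition3p1 k l r =
  bounded⇒finite ∘ OG-bounded⇒ROG-bounded _≟ᶠ_ l r ∘ finite⇒bounded ,
  bounded⇒finite ∘ ROG-bounded⇒OG-bounded _≟ᶠ_ l r ∘ finite⇒bounded
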